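{- Let $T:\mathcal V\text{ -cat}\to\mathcal V\text{ -cat}$ be a 2-functor satisfying BCC, let $\xi:\mathcal X\to T\mathcal X$ be a $T$-coalgebra, and let $\nabla:T^\partial\mathcal L\to\mathcal L$ be a $\mathcal V$-functor (a $T^\partial$-algebra). Let $\Vdash:\mathcal L\rightsquigarrow\mathcal X^{op}$ be a module (i.e. a $\mathcal V$-functor $\mathcal X\otimes\mathcal L\to\mathcal V$, written $\Vdash(x,\phi)$), and let $[\![\cdot]\!]:\mathcal L\to[\mathcal X,\mathcal V]$ be the corresponding $\mathcal V$-functor, $[\![\phi]\!](x)=\Vdash(x,\phi)$. Then $[\![\cdot]\!]\circ\nabla=[\xi,\mathcal V]\circ\delta_{\mathcal X^{op}}\circ T^\partial[\![\cdot]\!]$ as $\mathcal V$-functors $T^\partial\mathcal L\to[\mathcal X,\mathcal V]$ if and only if $\Vdash(x,\nabla\gamma)=\overline{T^\partial}(\Vdash)(\xi(x),\gamma)$ for all $x$ in $\mathcal X$ and $\gamma$ in $T^\partial\mathcal L$. Moreover, $\Vdash$ equals the composite module $\mathrm{ev}_{\mathcal X^{op}}\cdot([\![\cdot]\!])_\diamond$.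
   Context: $\mathcal V=(\mathcal V_o,\otimes,I,[-,-])$ is a commutative quantale: $\mathcal V_o$ a complete lattice, $\otimes$ commutative associative with unit $I$ preserving joins in each variable, $x\otimes y\le z$ iff $y\le[x,z]$. $\mathcal V$-categories have hom-values $\mathcal A(a,b)\in\mathcal V_o$ with $I\le\mathcal A(a,a)$, $\mathcal A(b,c)\otimes\mathcal A(a,b)\le\mathcal A(a,c)$; $\mathcal V$-functors satisfy $\mathcal A(a,a')\le\mathcal B(fa,fa')$; $\mathcal A^{op}(a,b)=\mathcal A(b,a)$; $[\mathcal A,\mathcal B]$ is the $\mathcal V$-category of $\mathcal V$-functors with homs $\bigwedge_a\mathcal B(fa,ga)$; $[\xi,\mathcal V]:[T\mathcal X,\mathcal V]\to[\mathcal X,\mathcal V]$ is precomposition with $\xi$. $\mathcal V\text{ -cat}$: 2-category of small $\mathcal V$-categories, $\mathcal V$-functors and the pointwise order. A module $R:\mathcal A\rightsquigarrow\mathcal B$ is a $\mathcal V$-functor $\mathcal B^{op}\otimes\mathcal A\to\mathcal V$; composition $(S\cdot R)(c,a)=\bigvee_bS(c,b)\otimes R(b,a)$; $f_\diamond(b,a)=\mathcal B(b,fa)$; $\mathcal V\text{ -mod}$ is the 2-category of modules. A lax square $fp_0\le gp_1$ is exact if $\mathcal C(fa,gb)=\bigvee_w\mathcal A(a,p_0w)\otimes\mathcal B(p_1w,b)$; BCC means preserving exact squares. $T^\partial\mathcal A=(T(\mathcal A^{op}))^{op}$, $T^\partial f=(T(f^{op}))^{op}$; if $T$ satisfies BCC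 so does $T^\partial$, hence $T^\partial$ has a unique relation lifting $\overline{T^\partial}:\mathcal V\text{ -mod}\to\mathcal V\text{ -mod}$ (2-functor with $\overline{T^\partial}(f_\diamond)=(T^\partial f)_\diamond$), given on $R:\mathcal A\rightsquigarrow\mathcal B$ with collage inclusions $i_0:\mathcal B\to\mathrm{Coll}(R)$, $i_1:\mathcal A\to\mathrm{Coll}(R)$ by $\overline{T^\partial}(R)(u,v)=T^\partial\mathrm{Coll}(R)(T^\partial i_0(u),T^\partial i_1(v))$; here $\mathrm{Coll}(R)$ has objects of $\mathcal A$ and $\mathcal B$, homs from $\mathcal A$, $\mathcal B$, $\mathrm{Coll}(R)(b,a)=R(b,a)$, $\mathrm{Coll}(R)(a,b)=\bot$. $\mathsf L\mathcal A=[\mathcal A^{op},\mathcal V]$. $\mathrm{ev}_{\mathcal A}:\mathsf L\mathcal A\rightsquigarrow\mathcal A$ is the module $\mathrm{ev}_{\mathcal A}(a,\phi)=\phi(a)$. The distributive law $\delta:T^\partial\mathsf L\to\mathsf LT^\partial$ corresponding to $\overline{T^\partial}$ is $\delta_{\mathcal A}(\Phi)(u)=\overline{T^\partial}(\mathrm{ev}_{\mathcal A})(u,\Phi)$ for $\Phi\in T^\partial\mathsf L\mathcal A$, $u\in T^\partial\mathcal A$; for $\mathcal A=\mathcal X^{op}$ it is a $\mathcal V$-functor $T^\partial[\mathcal X,\mathcal V]\to[T\mathcal X,\mathcal V]$. -}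

module Defs where

open import Level using (Level; suc; _⊔_)
open import Data.Sum using (_⊎_; inj₁; inj₂)
open import Data.Empty.Polymorphic using (⊥)
open import Relation.Binary.PropositionalEquality
  using (_≡_; refl; sym; trans; cong; subst)

record Quantale (ℓ : Level) : Set (suc ℓ) where
  infixr 7 _⊗_
  infix 4 _≤_
  field
    Carrier   : Set ℓ
    _≤_       : Carrier → Carrier → Set ℓ
    ≤-refl    : ∀ {x} → x ≤ x
    ≤-trans   : ∀ {x y z} → x ≤ y → y ≤ z → x ≤ z
    ≤-antisym : ∀ {x y} → x ≤ y → y ≤ x → x ≡ y
    ⋁         : {J : Set ℓ} → (J → Carrier) → Carrier
    ⋁-ub      : ∀ {J} (f : J → Carrier) (j : J) → f j ≤ ⋁ f
    ⋁-least   : ∀ {J} (f : J → Carrier) (z : Carrier) → (∀ j → f j ≤ z) → ⋁ f ≤ z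
    ⋀         : {J : Set ℓ} → (J → Carrier) → Carrier
    ⋀-lb      : ∀ {J} (f : J → Carrier) (j : J) → ⋀ f ≤ f j
    ⋀-greatest : ∀ {J} (f : J → Carrier) (z : Carrier) → (∀ j → z ≤ f j) → z ≤ ⋀ f
    _⊗_       : Carrier → Carrier → Carrier
    I         : Carrier
    ⊗-assoc   : ∀ x y z → (x ⊗ y) ⊗ z ≡ x ⊗ (y ⊗ z)
    ⊗-comm    : ∀ x y → x ⊗ y ≡ y ⊗ x
    ⊗-unitˡ   : ∀ x → I ⊗ x ≡ x
    ⊗-⋁ʳ      : ∀ x {J} (f : J → Carrier) → x ⊗ ⋁ f ≡ ⋁ (λ j → x ⊗ f j)
    ⊗-⋁ˡ      : ∀ x {J} (f : J → Carrier) → ⋁ f ⊗ x ≡ ⋁ (λ j → f j ⊗ x)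
    [_,_]     : Carrier → Carrier → Carrier
    adj→      : ∀ {x y z} → x ⊗ y ≤ z → y ≤ [ x , z ]
    adj←      : ∀ {x y z} → y ≤ [ x , z ] → x ⊗ y ≤ z

module Enriched {ℓ : Level} (Q : Quantale ℓ) where
  open Quantale Q

  ≡⇒≤ : ∀ {x y} → x ≡ y → x ≤ y
  ≡⇒≤ refl = ≤-refl

  ⊗-monoʳ : ∀ {x a b} → a ≤ b → x ⊗ a ≤ x ⊗ b
  ⊗-monoʳ a≤b = adj← (≤-trans a≤b (adj→ ≤-refl))

  ⊗-monoˡ : ∀ {x a b} → a ≤ b → a ⊗ x ≤ b ⊗ x
  ⊗-monoˡ {x} {a} {b} a≤b =
    ≤-trans (≡⇒≤ (⊗-comm a x)) (≤-trans (⊗-monoʳ a≤b) (≡⇒≤ (⊗-comm x b)))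

  ⊗-mono : ∀ {a b c d} → a ≤ b → c ≤ d → a ⊗ c ≤ b ⊗ d
  ⊗-mono p q = ≤-trans (⊗-monoˡ p) (⊗-monoʳ q)

  ⊗-unitʳ : ∀ x → x ⊗ I ≡ x
  ⊗-unitʳ x = trans (⊗-comm x I) (⊗-unitˡ x)

  ≤⊗ʳ : ∀ {x y} → I ≤ y → x ≤ x ⊗ y
  ≤⊗ʳ {x} p = ≤-trans (≡⇒≤ (sym (⊗-unitʳ x))) (⊗-monoʳ p)

  ≤⊗ˡ : ∀ {x y} → I ≤ y → x ≤ y ⊗ x
  ≤⊗ˡ {x} p = ≤-trans (≡⇒≤ (sym (⊗-unitˡ x))) (⊗-monoˡ p)

  ⊥V : Carrier
  ⊥V = ⋁ {⊥} (λ ())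

  ⊥V≤ : ∀ z → ⊥V ≤ z
  ⊥V≤ z = ⋁-least (λ ()) z (λ ())

  ⊗⊥≤ : ∀ x z → x ⊗ ⊥V ≤ z
  ⊗⊥≤ x z = adj← (⊥V≤ _)

  ⊥⊗≤ : ∀ x z → ⊥V ⊗ x ≤ z
  ⊥⊗≤ x z = ≤-trans (≡⇒≤ (⊗-comm ⊥V x)) (⊗⊥≤ x z)

  ihom-id : ∀ x → I ≤ [ x , x ]
  ihom-id x = adj→ (≡⇒≤ (⊗-unitʳ x))

  ihom-comp : ∀ x y z → [ y , z ] ⊗ [ x , y ] ≤ [ x , z ]
  ihom-comp x y z = adj→ (≤-trans (≡⇒≤ eq) (≤-trans (⊗-monoˡ (adj← ≤-refl)) (adj← ≤-refl)))
    where
    eq : x ⊗ ([ y , z ] ⊗ [ x , y ]) ≡ (x ⊗ [ x , y ]) ⊗ [ y , z ]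
    eq = trans (cong (x ⊗_) (⊗-comm [ y , z ] [ x , y ])) (sym (⊗-assoc x [ x , y ] [ y , z ]))

  -- Besides the composition law  V(b,c) ⊗ V(a,b) ≤ V(a,c)  we also store
  -- its mirror image  V(a,b) ⊗ V(b,c) ≤ V(a,c)  (equivalent by
  -- commutativity of ⊗; see mkVCat).  This makes (A ^op) ^op
  -- definitionally equal to A.

  record VCategory : Set (suc ℓ) where
    constructor vcat
    field
      Obj   : Set ℓ
      hom   : Obj → Obj → Carrier
      idl   : ∀ a → I ≤ hom a a
      comp  : ∀ a b c → hom b c ⊗ hom a b ≤ hom a c
      comp′ : ∀ a b c → hom a b ⊗ hom b c ≤ hom a c
  open VCategory public

  mkVCat : (O : Set ℓ) (h : O → O → Carrier) →
           (∀ a → I ≤ h a a) → (∀ a b c → h b c ⊗ h a b ≤ h a c) → VCategory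
  mkVCat O h i c = vcat O h i c (λ a b d → ≤-trans (≡⇒≤ (⊗-comm (h a b) (h b d))) (c a b d))

  record VFunctor (A B : VCategory) : Set ℓ where
    constructor vfun
    field
      map  : Obj A → Obj B
      mono : ∀ a a' → hom A a a' ≤ hom B (map a) (map a')
  open VFunctor public

  _^op : VCategory → VCategory
  A ^op = record
    { Obj   = Obj A
    ; hom   = λ a b → hom A b a
    ; idl   = idl A
    ; comp  = λ a b c → comp′ A c b a
    ; comp′ = λ a b c → comp A c b a
    }

  opF : ∀ {A B} → VFunctor A B → VFunctor (A ^op) (B ^op)
  opF f = record { map = map f ; mono = λ a a' → mono f a' a }

  idF : ∀ {A} → VFunctor A A
  idF = record { map = λ a → a ; mono = λ a a' → ≤-refl }

  _∘F_ : ∀ {A B C} → VFunctor B C → VFunctor A B → VFunctor A C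
  g ∘F f = record
    { map  = λ a → map g (map f a)
    ; mono = λ a a' → ≤-trans (mono f a a') (mono g (map f a) (map f a')) }

  _≤F_ : ∀ {A B} → VFunctor A B → VFunctor A B → Set ℓ
  _≤F_ {A} {B} f g = ∀ a → I ≤ hom B (map f a) (map g a)

  Vcat : VCategory
  Vcat = mkVCat Carrier [_,_] ihom-id ihom-comp

  Fun : VCategory → VCategory → VCategory
  Fun A B = mkVCat (VFunctor A B)
    (λ f g → ⋀ (λ a → hom B (map f a) (map g a)))
    (λ f → ⋀-greatest _ I (λ a → idl B (map f a)))
    (λ f g h → ⋀-greatest _ _ (λ a →
        ≤-trans (⊗-mono (⋀-lb _ a) (⋀-lb _ a)) (comp B (map f a) (map g a) (map h a))))

  𝕃 : VCategory → VCategory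
  𝕃 A = Fun (A ^op) Vcat

  -- Modules  R : A ⇝ B,  i.e. V-functors  B^op ⊗ A → V,  written out:
  --   (B^op ⊗ A)((b,a),(b',a')) = B(b',b) ⊗ A(a,a') ≤ [R(b,a), R(b',a')]

  record Module (A B : VCategory) : Set ℓ where
    constructor vmod
    field
      rel : Obj B → Obj A → Carrier
      law : ∀ b b' a a' → hom B b' b ⊗ hom A a a' ≤ [ rel b a , rel b' a' ]
  open Module public

  _·M_ : ∀ {A B C} → Module B C → Module A B → Obj C → Obj A → Carrier
  (S ·M R) c a = ⋁ (λ b → rel S c b ⊗ rel R b a)

  _⋄ : ∀ {A B} → VFunctor A B → Module A B
  _⋄ {A} {B} f = record
    { rel = λ b a → hom B b (map f a)
    ; law = λ b b' a a' → adj→ (≤-trans (⊗-monoʳ (⊗-monoʳ (mono f a a')))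
        (≤-trans (≡⇒≤ (rearr (hom B b (map f a)) (hom B b' b) (hom B (map f a) (map f a'))))
          (≤-trans (⊗-monoʳ (comp B b' b (map f a))) (comp B b' (map f a) (map f a')))))
    }
    where
    rearr : ∀ x y z → x ⊗ (y ⊗ z) ≡ z ⊗ (x ⊗ y)
    rearr x y z = trans (sym (⊗-assoc x y z)) (⊗-comm (x ⊗ y) z)

  ev : ∀ A → Module (𝕃 A) A
  ev A = record
    { rel = λ a φ → map φ a
    ; law = λ b b' φ φ' →
        ≤-trans (⊗-mono (mono φ b b') (⋀-lb _ b'))
          (≤-trans (≡⇒≤ (⊗-comm _ _)) (ihom-comp (map φ b) (map φ b') (map φ' b')))
    }

  module _ {A B : VCategory} (R : Module A B) where
    leftAct : ∀ b' b a → hom B b' b ⊗ rel R b a ≤ rel R b' a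
    leftAct b' b a = ≤-trans (≡⇒≤ (⊗-comm _ _))
      (adj← (≤-trans (≤⊗ʳ (idl A a)) (law R b b' a a)))

    rightAct : ∀ b a a' → hom A a a' ⊗ rel R b a ≤ rel R b a'
    rightAct b a a' = ≤-trans (≡⇒≤ (⊗-comm _ _))
      (adj← (≤-trans (≤⊗ˡ (idl B b)) (law R b b a a')))

    collHom : Obj A ⊎ Obj B → Obj A ⊎ Obj B → Carrier
    collHom (inj₁ a) (inj₁ a') = hom A a a'
    collHom (inj₁ a) (inj₂ b)  = ⊥V
    collHom (inj₂ b) (inj₁ a)  = rel R b a
    collHom (inj₂ b) (inj₂ b') = hom B b b'

    collId : ∀ x → I ≤ collHom x x
    collId (inj₁ a) = idl A a
    collId (inj₂ b) = idl B b

    collComp : ∀ x y z → collHom y z ⊗ collHom x y ≤ collHom x z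
    collComp (inj₁ a) (inj₁ a') (inj₁ a'') = comp A a a' a''
    collComp (inj₁ a) (inj₁ a') (inj₂ b)   = ⊥⊗≤ _ _
    collComp (inj₁ a) (inj₂ b)  z          = ⊗⊥≤ _ _
    collComp (inj₂ b) (inj₁ a)  (inj₁ a')  = rightAct b a a'
    collComp (inj₂ b) (inj₁ a)  (inj₂ b')  = ⊥⊗≤ _ _
    collComp (inj₂ b) (inj₂ b') (inj₁ a)   =
      ≤-trans (≡⇒≤ (⊗-comm _ _)) (leftAct b b' a)
    collComp (inj₂ b) (inj₂ b') (inj₂ b'') = comp B b b' b''

    Coll : VCategory
    Coll = mkVCat (Obj A ⊎ Obj B) collHom collId collComp

    i₀ : VFunctor B Coll
    i₀ = record { map = inj₂ ; mono = λ b b' → ≤-refl }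

    i₁ : VFunctor A Coll
    i₁ = record { map = inj₁ ; mono = λ a a' → ≤-refl }

  record TwoFunctor : Set (suc ℓ) where
    field
      F₀   : VCategory → VCategory
      F₁   : ∀ {A B} → VFunctor A B → VFunctor (F₀ A) (F₀ B)
      F-id : ∀ {A} (x : Obj (F₀ A)) → map (F₁ (idF {A})) x ≡ x
      F-∘  : ∀ {A B C} (g : VFunctor B C) (f : VFunctor A B) (x : Obj (F₀ A)) →
             map (F₁ (g ∘F f)) x ≡ map (F₁ g) (map (F₁ f) x)
      F-≤  : ∀ {A B} {f g : VFunctor A B} → f ≤F g → F₁ f ≤F F₁ g
  open TwoFunctor public

  record Exact {W A B C : VCategory}
               (p₀ : VFunctor W A) (p₁ : VFunctor W B)
               (f : VFunctor A C) (g : VFunctor B C) : Set ℓ where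
    field
      lax   : (f ∘F p₀) ≤F (g ∘F p₁)
      exact : ∀ a b → hom C (map f a) (map g b)
                      ≡ ⋁ (λ w → hom A a (map p₀ w) ⊗ hom B (map p₁ w) b)

  BCC : TwoFunctor → Set (suc ℓ)
  BCC T = ∀ {W A B C : VCategory}
            (p₀ : VFunctor W A) (p₁ : VFunctor W B)
            (f : VFunctor A C) (g : VFunctor B C) →
            Exact p₀ p₁ f g → Exact (F₁ T p₀) (F₁ T p₁) (F₁ T f) (F₁ T g)

  module _ (T : TwoFunctor) where
    T∂₀ : VCategory → VCategory
    T∂₀ A = (F₀ T (A ^op)) ^op

    T∂₁ : ∀ {A B} → VFunctor A B → VFunctor (T∂₀ A) (T∂₀ B)
    T∂₁ f = opF (F₁ T (opF f))

    T̄∂ : ∀ {A B} → Module A B → Obj (T∂₀ B) → Obj (T∂₀ A) → Carrier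
    T̄∂ R u v = hom (T∂₀ (Coll R)) (map (T∂₁ (i₀ R)) u) (map (T∂₁ (i₁ R)) v)

    -- the distributive law  δ_A(Φ)(u) = T̄∂(ev_A)(u, Φ)
    -- (object part: δ_A(Φ) ∈ L(T^∂ A), evaluated at u ∈ T^∂ A)
    δ : ∀ A → Obj (T∂₀ (𝕃 A)) → Obj (T∂₀ A) → Carrier
    δ A Φ u = T̄∂ (ev A) u Φ

  ⟦_⟧ : ∀ {X L} → Module L (X ^op) → VFunctor L (Fun X Vcat)
  ⟦_⟧ {X} {L} R = record
    { map  = λ φ → record
        { map  = λ x → rel R x φ
        ; mono = λ x x' → ≤-trans (≤⊗ʳ (idl L φ)) (law R x x' φ φ) }
    ; mono = λ φ φ' → ⋀-greatest _ _ (λ x → ≤-trans (≤⊗ˡ (idl X x)) (law R x x φ φ'))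
    }

-- The V-functor ⟦·⟧ extends to a V-functor between collages,
-- Coll(⊩) → Coll(ev), which is the identity on X^op and ⟦·⟧ on L.  Together
-- with the collage inclusions of X^op it forms an exact square: this is the
-- Yoneda lemma ⋁_w C(c, i₀ w) ⊗ X^op(b, w) = C(c, i₀ b).  By BCC the square
-- stays exact after applying T; reading off its homs at (T^∂ i₁ γ, u), and
-- using that T preserves collage⟦⟧ ∘ i₁ = i₁ ∘ ⟦·⟧ up to isomorphism, gives
-- T̄∂(⊩)(u, γ) = T̄∂(ev)(u, T^∂⟦·⟧ γ) = δ(T^∂⟦·⟧ γ)(u).  Hence the two sides
-- of the equivalence are the same equations, evaluated at u = ξ x.
-- The factorisation ⊩ = ev · ⟦·⟧_⋄ is the Yoneda lemma for presheaves.
module Submission where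

open import Defs
open import Data.Product using (_×_; _,_)
open import Data.Sum using (inj₁; inj₂)
open import Function.Bundles using (_⇔_; mk⇔)
open import Relation.Binary.PropositionalEquality
  using (_≡_; refl; sym; trans; cong; subst; subst₂; module ≡-Reasoning)

module _ {ℓ} (Q : Quantale ℓ) where
  open Quantale Q
  open Enriched Q

  ⋁-cong : ∀ {J} {f g : J → Carrier} → (∀ j → f j ≡ g j) → ⋁ f ≡ ⋁ g
  ⋁-cong {f = f} {g} f≗g = ≤-antisym
    (⋁-least f (⋁ g) (λ j → ≤-trans (≡⇒≤ (f≗g j)) (⋁-ub g j)))
    (⋁-least g (⋁ f) (λ j → ≤-trans (≡⇒≤ (sym (f≗g j))) (⋁-ub f j)))

  hom-≅ˡ : (C : VCategory) {a a' : Obj C} (b : Obj C) →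
           I ≤ hom C a a' → I ≤ hom C a' a → hom C a b ≡ hom C a' b
  hom-≅ˡ C {a} {a'} b a≤a' a'≤a = ≤-antisym
    (≤-trans (≤⊗ˡ a'≤a) (comp′ C a' a b))
    (≤-trans (≤⊗ˡ a≤a') (comp′ C a a' b))

  ≗⇒≤F : ∀ {A B} {f g : VFunctor A B} → (∀ a → map f a ≡ map g a) → f ≤F g
  ≗⇒≤F {B = B} {f} f≗g a = subst (λ z → I ≤ hom B (map f a) z) (f≗g a) (idl B (map f a))

  ⋁-yoneda : ∀ {D E} (p : VFunctor D E) (c : Obj E) (b : Obj D) →
             ⋁ (λ w → hom E c (map p w) ⊗ hom D w b) ≡ hom E c (map p b)
  ⋁-yoneda {D} {E} p c b = ≤-antisym
    (⋁-least _ _ (λ w → ≤-trans (⊗-monoʳ (mono p w b)) (comp′ E c (map p w) (map p b))))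
    (≤-trans (≤⊗ʳ (idl D b)) (⋁-ub (λ w → hom E c (map p w) ⊗ hom D w b) b))

  ev·⋄ : ∀ {A L} (f : VFunctor L (𝕃 A)) (a : Obj A) (φ : Obj L) →
         (ev A ·M (f ⋄)) a φ ≡ map (map f φ) a
  ev·⋄ {A} f a φ = ≤-antisym
    (⋁-least _ _ (λ ψ → ≤-trans (⊗-monoʳ (⋀-lb _ a)) (adj← ≤-refl)))
    (≤-trans (≤⊗ʳ (idl (𝕃 A) (map f φ)))
      (⋁-ub (λ ψ → map ψ a ⊗ hom (𝕃 A) ψ (map f φ)) (map f φ)))

  module _ {X L : VCategory} (R : Module L (X ^op)) where

    collage⟦⟧ : VFunctor (Coll R) (Coll (ev (X ^op)))
    collage⟦⟧ = vfun onObj onHom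
      where
      onObj : Obj (Coll R) → Obj (Coll (ev (X ^op)))
      onObj (inj₁ φ) = inj₁ (map ⟦ R ⟧ φ)
      onObj (inj₂ x) = inj₂ x

      onHom : ∀ c c′ → hom (Coll R) c c′ ≤ hom (Coll (ev (X ^op))) (onObj c) (onObj c′)
      onHom (inj₁ φ) (inj₁ φ′) = mono ⟦ R ⟧ φ φ′
      onHom (inj₁ φ) (inj₂ x)  = ≤-refl
      onHom (inj₂ x) (inj₁ φ)  = ≤-refl
      onHom (inj₂ x) (inj₂ x′) = ≤-refl

    collage⟦⟧-i₀-exact :
      Exact (opF (i₀ R)) (idF {X}) (opF collage⟦⟧) (opF (i₀ (ev (X ^op))))
    collage⟦⟧-i₀-exact = record
      { lax   = idl X
      ; exact = λ c b → trans (fully-faithful c b) (sym (⋁-yoneda (opF (i₀ R)) c b))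
      }
      where
      fully-faithful : ∀ c b → hom (Coll (ev (X ^op))) (inj₂ b) (map collage⟦⟧ c)
                               ≡ hom (Coll R) (inj₂ b) c
      fully-faithful (inj₁ φ) b = refl
      fully-faithful (inj₂ x) b = refl

  module _ (T : TwoFunctor) where

    F₁-≅ : ∀ {A B B′ C} (g : VFunctor B C) (f : VFunctor A B)
             (g′ : VFunctor B′ C) (f′ : VFunctor A B′) →
           (∀ a → map g (map f a) ≡ map g′ (map f′ a)) → (x : Obj (F₀ T A)) →
           I ≤ hom (F₀ T C) (map (F₁ T g) (map (F₁ T f) x)) (map (F₁ T g′) (map (F₁ T f′) x))
    F₁-≅ {C = C} g f g′ f′ commutes x =
      subst₂ (λ y z → I ≤ hom (F₀ T C) y z) (F-∘ T g f x) (F-∘ T g′ f′ x)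
        (F-≤ T (≗⇒≤F {f = g ∘F f} {g′ ∘F f′} commutes) x)

    module _ (bcc : BCC T) {X L : VCategory} (R : Module L (X ^op)) where

      T-collage⟦⟧-i₀ : ∀ c u →
        hom (F₀ T (Coll (ev (X ^op)) ^op))
            (map (F₁ T (opF (collage⟦⟧ R))) c) (map (F₁ T (opF (i₀ (ev (X ^op))))) u)
        ≡ hom (F₀ T (Coll R ^op)) c (map (F₁ T (opF (i₀ R))) u)
      T-collage⟦⟧-i₀ c u = begin
        _ ≡⟨ Exact.exact (bcc _ _ _ _ (collage⟦⟧-i₀-exact R)) c u ⟩
        ⋁ (λ w → hom TC c (Ti₀ w) ⊗ hom TX (map (F₁ T idF) w) u)
          ≡⟨ ⋁-cong (λ w → cong (λ v → hom TC c (Ti₀ w) ⊗ hom TX v u) (F-id T w)) ⟩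
        ⋁ (λ w → hom TC c (Ti₀ w) ⊗ hom TX w u)
          ≡⟨ ⋁-yoneda (F₁ T (opF (i₀ R))) c u ⟩
        hom TC c (Ti₀ u) ∎
        where
        open ≡-Reasoning
        TC TX : VCategory
        TC = F₀ T (Coll R ^op)
        TX = F₀ T X
        Ti₀ : Obj TX → Obj TC
        Ti₀ = map (F₁ T (opF (i₀ R)))

      δ-T∂⟦⟧≡T̄∂ : ∀ u γ → δ T (X ^op) (map (T∂₁ T ⟦ R ⟧) γ) u ≡ T̄∂ T R u γ
      δ-T∂⟦⟧≡T̄∂ u γ = trans
        (hom-≅ˡ (F₀ T (Coll (ev (X ^op)) ^op)) _
          (F₁-≅ (opF (i₁ (ev (X ^op)))) (opF ⟦ R ⟧) (opF (collage⟦⟧ R)) (opF (i₁ R)) (λ _ → refl) γ)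
          (F₁-≅ (opF (collage⟦⟧ R)) (opF (i₁ R)) (opF (i₁ (ev (X ^op)))) (opF ⟦ R ⟧) (λ _ → refl) γ))
        (T-collage⟦⟧-i₀ (map (F₁ T (opF (i₁ R))) γ) u)

proposition7p7 :
    ∀ {ℓ} (Q : Quantale ℓ) → let open Enriched Q in
    (T : TwoFunctor) → BCC T →
    (X L : VCategory) (ξ : VFunctor X (F₀ T X)) (∇ : VFunctor (T∂₀ T L) L)
    (⊩ : Module L (X ^op)) →
    ( (∀ (γ : Obj (T∂₀ T L)) (x : Obj X) →
         map (map ⟦ ⊩ ⟧ (map ∇ γ)) x
           ≡ δ T (X ^op) (map (T∂₁ T ⟦ ⊩ ⟧) γ) (map ξ x))
      ⇔
      (∀ (x : Obj X) (γ : Obj (T∂₀ T L)) →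
         rel ⊩ x (map ∇ γ) ≡ T̄∂ T ⊩ (map ξ x) γ) )
    ×
    (∀ (x : Obj X) (φ : Obj L) → rel ⊩ x φ ≡ (ev (X ^op) ·M (⟦ ⊩ ⟧ ⋄)) x φ)
proposition7p7 Q T bcc X L ξ ∇ ⊩ =
  mk⇔ (λ h x γ → trans (h γ x) (δ-T∂⟦⟧≡T̄∂ Q T bcc ⊩ (map ξ x) γ))
      (λ h γ x → trans (h x γ) (sym (δ-T∂⟦⟧≡T̄∂ Q T bcc ⊩ (map ξ x) γ)))
  , λ x φ → sym (ev·⋄ Q ⟦ ⊩ ⟧ x φ)
  where open Enriched Q using (map; ⟦_⟧)
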